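{- Let $H$ be a $(0,1,2)$-multigraph of order $n\ge 3$ with exactly two distinct main eigenvalues whose $B$-graph is the cycle $C_n$, and let $a,b$ be integers such that $a\,d(v)+b=s(v)$ for every $v\in V(H)$. Label the vertices as follows: if $n$ is even, $V(H)=\{u_1,\dots,u_{n/2},v_1,\dots,v_{n/2}\}$ with $u_1u_2\cdots u_{n/2}v_{n/2}\cdots v_2v_1u_1$ the cycle of the $B$-graph; if $n$ is odd, $V(H)=\{u_1,\dots,u_{(n-1)/2},v_1,\dots,v_{(n-1)/2},x\}$ with $u_1\cdots u_{(n-1)/2}\,x\,v_{(n-1)/2}\cdots v_1u_1$ the cycle; and assume $w(u_1,v_1)=2$. If $w(u_1,u_2)=1$ and $w(v_1,v_2)=2$, then $H$ is isomorphic to one of $U^3_{3t}$, $U^4_{5t}$, $U^5_{4t}$ for some $t\ge 1$.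
   Context: A $(0,1,2)$-multigraph $H$ is a loopless multigraph in which any two distinct vertices $u,v$ are joined by $w(u,v)\in\{0,1,2\}$ edges; its adjacency matrix has $(u,v)$-entry $w(u,v)$. The degree is $d(v)=\sum_u w(u,v)$ and $s(v)=\sum_{u\sim v}w(u,v)d(u)$. The $B$-graph of $H$ is the simple graph on $V(H)$ with $u\sim v$ iff $w(u,v)\ge1$. An eigenvalue of the adjacency matrix is main if its eigenspace is not orthogonal to the all-ones vector. For $n_1\ge1,n_2\ge0,t\ge1$, $[n_1,n_2]_t$ denotes the $(0,1,2)$-multigraph on $x_0,\dots,x_{N-1}$, $N=(n_1+n_2)t$, whose edges join $x_i$ and $x_{i+1\bmod N}$ with multiplicity $2$ if $(i\bmod(n_1+n_2))<n_1$ and $1$ otherwise (around the cycle: $n_1$ consecutive double edges then $n_2$ consecutive single edges, repeated $t$ times). $U^3_{3t}=[2,1]_t$, $U^4_{5t}=[3,2]_t$, $U^5_{4t}=[3,1]_t$. -}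

module Defs where

open import Level using (Level)
open import Data.Nat using (ℕ; zero; suc; _+_; _*_; _≤_; _∸_; _<?_)
open import Data.Bool using (if_then_else_)
open import Relation.Nullary.Decidable using (⌊_⌋)
open import Data.Fin as Fin using (Fin; toℕ; fromℕ<)
open import Data.Fin.Base using (zero; suc)
open import Data.Nat.DivMod using (_%_)
open import Data.Integer as ℤ using (ℤ)
open import Data.Product using (Σ; _×_; ∃; ∃-syntax; _,_)
open import Data.Sum using (_⊎_)
open import Relation.Nullary using (¬_)
open import Relation.Binary.PropositionalEquality using (_≡_)
open import Function.Bundles using (_⤖_; Bijection)
open import Algebra.Bundles using (CommutativeRing)

sumFin : ∀ {n} → (Fin n → ℕ) → ℕ
sumFin {zero}  f = 0
sumFin {suc n} f = f zero + sumFin (λ i → f (suc i))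

record Multigraph012 (n : ℕ) : Set where
  field
    w         : Fin n → Fin n → ℕ
    w-sym     : ∀ u v → w u v ≡ w v u
    loopless  : ∀ v → w v v ≡ 0
    w≤2       : ∀ u v → w u v ≤ 2
open Multigraph012 public

deg : ∀ {n} → Multigraph012 n → Fin n → ℕ
deg H v = sumFin (λ u → w H u v)

-- s(v) = Σ_{u ~ v} w(u,v) d(u)  (non-neighbours contribute w(u,v) = 0)
sdeg : ∀ {n} → Multigraph012 n → Fin n → ℕ
sdeg H v = sumFin (λ u → w H u v * deg H u)

B-adj : ∀ {n} → Multigraph012 n → Fin n → Fin n → Set
B-adj H u v = 1 ≤ w H u v

sucMod : ∀ {n} → Fin n → Fin n
sucMod {suc n} i = fromℕ< {suc (toℕ i) % suc n} (Data.Nat.DivMod.m%n<n (suc (toℕ i)) (suc n))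

-- c : Fin n ⤖ V(H) lists the vertices in cyclic order c 0, c 1, …, c (n-1), c 0,
-- and this is exactly the B-graph: c i ~ c j iff j ≡ i+1 mod n or i ≡ j+1 mod n.
-- (For n ≥ 3 this says the B-graph is the cycle C_n with this traversal.)
IsBCycle : ∀ {n} → Multigraph012 n → (Fin n ⤖ Fin n) → Set
IsBCycle {n} H c =
  ∀ i j → (B-adj H (f i) (f j) → (j ≡ sucMod i ⊎ i ≡ sucMod j))
        × ((j ≡ sucMod i ⊎ i ≡ sucMod j) → B-adj H (f i) (f j))
  where f = Bijection.to c

-- Eigenvalues / main eigenvalues of the adjacency matrix over a commutative ring R
-- (the paper works over ℝ).
module Spectral {c ℓ : Level} (R : CommutativeRing c ℓ) where
  open CommutativeRing R using (0#; 1#; _≈_) renaming (Carrier to K; _+_ to _+K_; _*_ to _*K_)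

  embℕ : ℕ → K
  embℕ zero    = 0#
  embℕ (suc k) = 1# +K embℕ k

  sumK : ∀ {n} → (Fin n → K) → K
  sumK {zero}  f = 0#
  sumK {suc n} f = f zero +K sumK (λ i → f (suc i))

  adjMul : ∀ {n} → Multigraph012 n → (Fin n → K) → Fin n → K
  adjMul H x v = sumK (λ u → embℕ (w H v u) *K x u)

  IsMainEigenvalue : ∀ {n} → Multigraph012 n → K → Set (c Level.⊔ ℓ)
  IsMainEigenvalue H μ =
    Σ (_ → K) λ x → (∀ v → adjMul H x v ≈ μ *K x v) × ¬ (sumK x ≈ 0#)

  HasExactlyTwoMainEigenvalues : ∀ {n} → Multigraph012 n → Set (c Level.⊔ ℓ)
  HasExactlyTwoMainEigenvalues H =
    Σ K λ λ₁ → Σ K λ λ₂ → ¬ (λ₁ ≈ λ₂) × IsMainEigenvalue H λ₁ × IsMainEigenvalue H λ₂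
      × (∀ μ → IsMainEigenvalue H μ → μ ≈ λ₁ ⊎ μ ≈ λ₂)

-- [n₁,n₂]_t : vertices x_0,…,x_{N-1} (= Fin N, N = (n₁+n₂)t); the edge x_i x_{i+1 mod N}
-- has multiplicity 2 if (i mod (n₁+n₂)) < n₁ and 1 otherwise; no other edges.
-- Requires n₁ ≥ 1, so n₁ = suc m₁.
cycEdgeW : (m₁ n₂ : ℕ) → ℕ → ℕ
cycEdgeW m₁ n₂ i = if ⌊ i % (suc m₁ + n₂) <? suc m₁ ⌋ then 2 else 1

bracketN : (m₁ n₂ t : ℕ) → ℕ
bracketN m₁ n₂ t = (suc m₁ + n₂) * t

bracketW : (m₁ n₂ t : ℕ) → Fin (bracketN m₁ n₂ t) → Fin (bracketN m₁ n₂ t) → ℕ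
bracketW m₁ n₂ t i j =
  if ⌊ j Fin.≟ sucMod i ⌋ then cycEdgeW m₁ n₂ (toℕ i)
  else if ⌊ i Fin.≟ sucMod j ⌋ then cycEdgeW m₁ n₂ (toℕ j)
  else 0

Isomorphic : ∀ {n N} → Multigraph012 n → (Fin N → Fin N → ℕ) → Set
Isomorphic {n} {N} H w′ =
  Σ (Fin n ⤖ Fin N) λ σ → ∀ u v → w H u v ≡ w′ (Bijection.to σ u) (Bijection.to σ v)

-- U^3_{3t} = [2,1]_t, U^4_{5t} = [3,2]_t, U^5_{4t} = [3,1]_t
U3 : (t : ℕ) → Fin (bracketN 1 1 t) → Fin (bracketN 1 1 t) → ℕ
U3 t = bracketW 1 1 t
U4 : (t : ℕ) → Fin (bracketN 2 2 t) → Fin (bracketN 2 2 t) → ℕ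
U4 t = bracketW 2 2 t
U5 : (t : ℕ) → Fin (bracketN 2 1 t) → Fin (bracketN 2 1 t) → ℕ
U5 t = bracketW 2 1 t

-- Positions in the cyclic order c 0, …, c (n-1) (for n ≥ 4):
-- u₁ = c 0, u₂ = c 1, v₁ = c (n-1), v₂ = c (n-2).
pos0 pos1 posLast posLast2 : ∀ {n} → 4 ≤ n → Fin n
pos0 (Data.Nat.s≤s _) = zero
pos1 (Data.Nat.s≤s (Data.Nat.s≤s _)) = suc zero
posLast {suc (suc (suc (suc m)))} (Data.Nat.s≤s (Data.Nat.s≤s (Data.Nat.s≤s (Data.Nat.s≤s _)))) = Fin.fromℕ (suc (suc (suc m)))
posLast2 {suc (suc (suc (suc m)))} (Data.Nat.s≤s (Data.Nat.s≤s (Data.Nat.s≤s (Data.Nat.s≤s _)))) = Fin.inject₁ (Fin.fromℕ (suc (suc m)))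

{-# OPTIONS --safe #-}
-- Let e₀, e₁, … ∈ {1, 2} be the edge weights along the cycle. At the vertex between the edges of
-- weights e_{k+1} and e_{k+2} the relation a·d + b = s reads
--   a (e_{k+1} + e_{k+2}) + b = e_{k+1} (e_k + e_{k+1}) + e_{k+2} (e_{k+2} + e_{k+3}),
-- so, as e_{k+2} ≠ 0, three consecutive weights determine the next one. Reading the weights from
-- the edge preceding v₂v₁, they begin x, 2, 2, 1, y. The relations at v₁ (degree 4) and u₁
-- (degree 3) determine a and b from x and y: x = y = 1 forces the weight after y to be 4, and the
-- other three choices give (a, b) = (1, 8), (4, −2), (3, 2), whose weight sequences are those of
-- U³, U⁴ and U⁵. Since the weights have period n, n is a multiple of the length of the pattern,
-- and a rotation of the cycle maps H onto the corresponding [n₁, n₂]_t.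
module Submission where

open import Defs
open import Level using (Level)
open import Data.Nat using (ℕ; _≤_)
open import Data.Fin using (Fin)
open import Data.Product using (_×_; ∃-syntax)
open import Data.Sum using (_⊎_)
open import Relation.Binary.PropositionalEquality using (_≡_)
open import Function.Bundles using (_⤖_; Bijection)
open import Algebra.Bundles using (CommutativeRing)

module _ where
  open import Data.Nat using (zero; suc; _+_; _*_; z≤n; s≤s; _<?_; NonZero)
  open import Data.Nat.Properties
    using (+-comm; +-assoc; +-identityʳ; +-cancelˡ-≡; *-comm; *-cancelˡ-≡; <⇒≱; ≰⇒>; n<1⇒n≡0)
  open import Data.Nat.DivMod
    using ( _%_; _/_; m≡m%n+[m/n]*n; m<n⇒m%n≡m; n%n≡0; m%n%n≡m%n; %-distribˡ-+; %-remove-+ˡ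
          ; m∣n⇒o%n%m≡o%m)
  open import Data.Nat.Divisibility using (_∣_; divides; ∣-refl; _∣0; ∣m∣n⇒∣m+n; ∣⇒≤)
  open import Data.Fin using (zero; suc; toℕ; fromℕ; inject₁; _≟_)
  open import Data.Fin.Properties
    using (toℕ-injective; toℕ-fromℕ<; toℕ-fromℕ; toℕ-inject₁; toℕ<n; suc-injective)
  open import Data.Integer using (ℤ; +_; -[1+_])
  import Data.Integer as ℤ
  open import Data.Integer.Properties using (+-injective)
  open import Data.Integer.Tactic.RingSolver using (solve-∀)
  open import Data.Bool using (if_then_else_)
  open import Data.Empty using (⊥-elim)
  open import Data.Product using (_,_; proj₁; proj₂)
  open import Data.Sum using (inj₁; inj₂; [_,_]′)
  open import Relation.Nullary using (yes; no; contradiction)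
  open import Relation.Nullary.Decidable using (⌊_⌋)
  open import Relation.Binary.PropositionalEquality
    using (refl; sym; trans; cong; cong₂; subst; _≢_; _≗_; module ≡-Reasoning)
  open import Function using (_∘_)
  open import Function.Bundles using (mk↔ₛ′; Surjection)
  open import Function.Properties.Inverse using (↔⇒⤖)
  open import Function.Construct.Identity using (⤖-id)
  open import Function.Construct.Composition using (_⤖-∘_)
  open import Function.Construct.Symmetry using (⤖-sym)
  open ≡-Reasoning

  -- Rotations of Fin (suc m)

  module _ {m : ℕ} where

    toℕ-sucMod : (i : Fin (suc m)) → toℕ (sucMod i) ≡ suc (toℕ i) % suc m
    toℕ-sucMod i = toℕ-fromℕ< _

    sucMod-inject₁ : (i : Fin m) → sucMod (inject₁ i) ≡ suc i
    sucMod-inject₁ i = toℕ-injective (begin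
      toℕ (sucMod (inject₁ i))       ≡⟨ toℕ-sucMod (inject₁ i) ⟩
      suc (toℕ (inject₁ i)) % suc m  ≡⟨ cong (λ x → suc x % suc m) (toℕ-inject₁ i) ⟩
      suc (toℕ i) % suc m            ≡⟨ m<n⇒m%n≡m (s≤s (toℕ<n i)) ⟩
      suc (toℕ i)                    ∎)

    sucMod-fromℕ : sucMod (fromℕ m) ≡ zero
    sucMod-fromℕ = toℕ-injective (begin
      toℕ (sucMod (fromℕ m))       ≡⟨ toℕ-sucMod (fromℕ m) ⟩
      suc (toℕ (fromℕ m)) % suc m  ≡⟨ cong (λ x → suc x % suc m) (toℕ-fromℕ m) ⟩
      suc m % suc m                ≡⟨ n%n≡0 (suc m) ⟩
      0                            ∎)

    rotate : ℕ → Fin (suc m) → Fin (suc m)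
    rotate zero    i = i
    rotate (suc r) i = sucMod (rotate r i)

    rotate-sucMod : ∀ r i → rotate r (sucMod i) ≡ sucMod (rotate r i)
    rotate-sucMod zero    i = refl
    rotate-sucMod (suc r) i = cong sucMod (rotate-sucMod r i)

    rotate-+ : ∀ r k i → rotate (r + k) i ≡ rotate r (rotate k i)
    rotate-+ zero    k i = refl
    rotate-+ (suc r) k i = cong sucMod (rotate-+ r k i)

    [1+x%n]%n≡[1+x]%n : ∀ x → suc (x % suc m) % suc m ≡ suc x % suc m
    [1+x%n]%n≡[1+x]%n x = begin
      (1 + x % suc m) % suc m                  ≡⟨ %-distribˡ-+ 1 (x % suc m) (suc m) ⟩
      (1 % suc m + x % suc m % suc m) % suc m  ≡⟨ cong (λ y → (1 % suc m + y) % suc m) (m%n%n≡m%n x (suc m)) ⟩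
      (1 % suc m + x % suc m) % suc m          ≡⟨ %-distribˡ-+ 1 x (suc m) ⟨
      (1 + x) % suc m                          ∎

    toℕ-rotate : ∀ r i → toℕ (rotate r i) ≡ (r + toℕ i) % suc m
    toℕ-rotate zero    i = sym (m<n⇒m%n≡m (toℕ<n i))
    toℕ-rotate (suc r) i = begin
      toℕ (sucMod (rotate r i))          ≡⟨ toℕ-sucMod (rotate r i) ⟩
      suc (toℕ (rotate r i)) % suc m     ≡⟨ cong (λ x → suc x % suc m) (toℕ-rotate r i) ⟩
      suc ((r + toℕ i) % suc m) % suc m  ≡⟨ [1+x%n]%n≡[1+x]%n (r + toℕ i) ⟩
      suc (r + toℕ i) % suc m            ∎

    rotate-period : ∀ i → rotate (suc m) i ≡ i
    rotate-period i = toℕ-injective (begin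
      toℕ (rotate (suc m) i)   ≡⟨ toℕ-rotate (suc m) i ⟩
      (suc m + toℕ i) % suc m  ≡⟨ %-remove-+ˡ (toℕ i) ∣-refl ⟩
      toℕ i % suc m            ≡⟨ m<n⇒m%n≡m (toℕ<n i) ⟩
      toℕ i                    ∎)

    rotate-toℕ : ∀ i → rotate (toℕ i) zero ≡ i
    rotate-toℕ i = toℕ-injective (begin
      toℕ (rotate (toℕ i) zero)  ≡⟨ toℕ-rotate (toℕ i) zero ⟩
      (toℕ i + 0) % suc m        ≡⟨ cong (_% suc m) (+-identityʳ (toℕ i)) ⟩
      toℕ i % suc m              ≡⟨ m<n⇒m%n≡m (toℕ<n i) ⟩
      toℕ i                      ∎)

    -- A fixed point of the rotation by 2 would make suc m divide 2.
    rotate-two-≢ : 2 ≤ m → ∀ i → rotate 2 i ≢ i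
    rotate-two-≢ m≥2 i eq = <⇒≱ (s≤s m≥2) (∣⇒≤ (divides q (+-cancelˡ-≡ x 2 (q * suc m) x+2≡x+q[1+m])))
      where
      x = toℕ i
      q = (2 + x) / suc m
      x+2≡x+q[1+m] : x + 2 ≡ x + q * suc m
      x+2≡x+q[1+m] = begin
        x + 2                        ≡⟨ +-comm x 2 ⟩
        2 + x                        ≡⟨ m≡m%n+[m/n]*n (2 + x) (suc m) ⟩
        (2 + x) % suc m + q * suc m  ≡⟨ cong (_+ q * suc m) (trans (sym (toℕ-rotate 2 i)) (cong toℕ eq)) ⟩
        x + q * suc m                ∎

    sucMod-⤖ : Fin (suc m) ⤖ Fin (suc m)
    sucMod-⤖ = ↔⇒⤖ (mk↔ₛ′ sucMod (rotate m) rotate-period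
                             (λ i → trans (rotate-sucMod m i) (rotate-period i)))

    rotation : ℕ → Fin (suc m) ⤖ Fin (suc m)
    rotation zero    = ⤖-id _
    rotation (suc r) = sucMod-⤖ ⤖-∘ rotation r

    to-rotation : ∀ r i → Bijection.to (rotation r) i ≡ rotate r i
    to-rotation zero    i = refl
    to-rotation (suc r) i = cong sucMod (to-rotation r i)

    rotate-injective : ∀ r {i j} → rotate r i ≡ rotate r j → i ≡ j
    rotate-injective r {i} {j} eq =
      Bijection.injective (rotation r) (trans (to-rotation r i) (trans eq (sym (to-rotation r j))))

    rotate-≡-sucMod : ∀ r {i j} → rotate r j ≡ sucMod (rotate r i) → j ≡ sucMod i
    rotate-≡-sucMod r {i} eq = rotate-injective r (trans eq (sym (rotate-sucMod r i)))

  sumFin-zero : ∀ {n} (f : Fin n → ℕ) → (∀ u → f u ≡ 0) → sumFin f ≡ 0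
  sumFin-zero {zero}  f f≡0 = refl
  sumFin-zero {suc n} f f≡0 = cong₂ _+_ (f≡0 zero) (sumFin-zero (f ∘ suc) (f≡0 ∘ suc))

  sumFin-single : ∀ {n} (f : Fin n → ℕ) p → (∀ u → u ≢ p → f u ≡ 0) → sumFin f ≡ f p
  sumFin-single {suc n} f zero f≡0 =
    trans (cong (_+_ (f zero)) (sumFin-zero (f ∘ suc) (λ u → f≡0 (suc u) λ ()))) (+-identityʳ (f zero))
  sumFin-single {suc n} f (suc p) f≡0 =
    cong₂ _+_ (f≡0 zero λ ()) (sumFin-single (f ∘ suc) p (λ u u≢p → f≡0 (suc u) (u≢p ∘ suc-injective)))

  sumFin-pair : ∀ {n} (f : Fin n → ℕ) {p q} → p ≢ q → (∀ u → u ≢ p → u ≢ q → f u ≡ 0) →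
                sumFin f ≡ f p + f q
  sumFin-pair {suc n} f {zero}  {zero}  p≢q f≡0 = ⊥-elim (p≢q refl)
  sumFin-pair {suc n} f {zero}  {suc q} p≢q f≡0 =
    cong (_+_ (f zero)) (sumFin-single (f ∘ suc) q (λ u u≢q → f≡0 (suc u) (λ ()) (u≢q ∘ suc-injective)))
  sumFin-pair {suc n} f {suc p} {zero}  p≢q f≡0 =
    trans (cong (_+_ (f zero)) (sumFin-single (f ∘ suc) p (λ u u≢p → f≡0 (suc u) (u≢p ∘ suc-injective) (λ ()))))
          (+-comm (f zero) (f (suc p)))
  sumFin-pair {suc n} f {suc p} {suc q} p≢q f≡0 =
    cong₂ _+_ (f≡0 zero (λ ()) (λ ()))
              (sumFin-pair (f ∘ suc) (p≢q ∘ cong suc)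
                           (λ u u≢p u≢q → f≡0 (suc u) (u≢p ∘ suc-injective) (u≢q ∘ suc-injective)))

  -- The relation a·d + b = s along a sequence of edge weights

  -- a·d(v) + b = s(v) at a vertex v of a cycle whose two edges have weights y and z, when the
  -- edges beyond its two neighbours have weights x and u.
  record DegreeRelation (a b : ℤ) (x y z u : ℕ) : Set where
    constructor holds
    field equation : a ℤ.* + (y + z) ℤ.+ b ≡ + (y * (x + y) + z * (z + u))
  open DegreeRelation

  DegreeRelationAlong : ℤ → ℤ → (ℕ → ℕ) → Set
  DegreeRelationAlong a b D = ∀ k → DegreeRelation a b (D k) (D (1 + k)) (D (2 + k)) (D (3 + k))

  DegreeRelation-cong : ∀ {a b x y z u x′ y′ z′ u′} → x ≡ x′ → y ≡ y′ → z ≡ z′ → u ≡ u′ →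
                        DegreeRelation a b x y z u → DegreeRelation a b x′ y′ z′ u′
  DegreeRelation-cong refl refl refl refl r = r

  DegreeRelation-unique : ∀ {a b x y z u u′} → 1 ≤ z →
                          DegreeRelation a b x y z u → DegreeRelation a b x y z u′ → u ≡ u′
  DegreeRelation-unique {x = x} {y} {suc z} {u} {u′} _ r r′ =
    +-cancelˡ-≡ (suc z) u u′ (*-cancelˡ-≡ (suc z + u) (suc z + u′) (suc z)
      (+-cancelˡ-≡ (y * (x + y)) _ _ (+-injective (trans (sym (equation r)) (equation r′)))))

  DegreeRelationAlong-unique : ∀ {a b D E} → (∀ k → 1 ≤ D k) →
                               DegreeRelationAlong a b D → DegreeRelationAlong a b E →
                               D 0 ≡ E 0 → D 1 ≡ E 1 → D 2 ≡ E 2 → D ≗ E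
  DegreeRelationAlong-unique {D = D} {E} D≥1 relD relE e₀ e₁ e₂ k = proj₁ (agree k)
    where
    agree : ∀ k → D k ≡ E k × D (1 + k) ≡ E (1 + k) × D (2 + k) ≡ E (2 + k)
    agree zero    = e₀ , e₁ , e₂
    agree (suc k) with agree k
    ... | eₖ , eₖ₊₁ , eₖ₊₂ =
      eₖ₊₁ , eₖ₊₂ , DegreeRelation-unique (subst (1 ≤_) eₖ₊₂ (D≥1 (2 + k)))
                                          (DegreeRelation-cong eₖ eₖ₊₁ eₖ₊₂ refl (relD k)) (relE k)

  affine-determined-by-3-and-4 : ∀ {a b a′ b′} →
    a ℤ.* + 4 ℤ.+ b ≡ a′ ℤ.* + 4 ℤ.+ b′ → a ℤ.* + 3 ℤ.+ b ≡ a′ ℤ.* + 3 ℤ.+ b′ → a ≡ a′ × b ≡ b′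
  affine-determined-by-3-and-4 {a} {b} {a′} {b′} at4 at3 = a≡a′ , b≡b′
    where
    slope : ∀ c d → c ≡ (c ℤ.* + 4 ℤ.+ d) ℤ.- (c ℤ.* + 3 ℤ.+ d)
    slope = solve-∀
    intercept : ∀ c d → d ≡ (c ℤ.* + 3 ℤ.+ d) ℤ.- c ℤ.* + 3
    intercept = solve-∀
    a≡a′ : a ≡ a′
    a≡a′ = begin
      a                                            ≡⟨ slope a b ⟩
      (a ℤ.* + 4 ℤ.+ b) ℤ.- (a ℤ.* + 3 ℤ.+ b)      ≡⟨ cong₂ ℤ._-_ at4 at3 ⟩
      (a′ ℤ.* + 4 ℤ.+ b′) ℤ.- (a′ ℤ.* + 3 ℤ.+ b′)  ≡⟨ slope a′ b′ ⟨
      a′                                           ∎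
    b≡b′ : b ≡ b′
    b≡b′ = begin
      b                                   ≡⟨ intercept a b ⟩
      (a ℤ.* + 3 ℤ.+ b) ℤ.- a ℤ.* + 3     ≡⟨ cong₂ ℤ._-_ at3 (cong (ℤ._* + 3) a≡a′) ⟩
      (a′ ℤ.* + 3 ℤ.+ b′) ℤ.- a′ ℤ.* + 3  ≡⟨ intercept a′ b′ ⟨
      b′                                  ∎

  -- The edge weights of [n₁, n₂]_t

  IsPeriod : (ℕ → ℕ) → ℕ → Set
  IsPeriod D p = ∀ k → D (p + k) ≡ D k

  cycEdgeW-cong : ∀ m₁ n₂ {x y} → x % (suc m₁ + n₂) ≡ y % (suc m₁ + n₂) → cycEdgeW m₁ n₂ x ≡ cycEdgeW m₁ n₂ y
  cycEdgeW-cong m₁ n₂ = cong (λ r → if ⌊ r <? suc m₁ ⌋ then 2 else 1)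

  cycEdgeW-% : ∀ m₁ n₂ {N} .{{_ : NonZero N}} x → suc m₁ + n₂ ∣ N → cycEdgeW m₁ n₂ (x % N) ≡ cycEdgeW m₁ n₂ x
  cycEdgeW-% m₁ n₂ {N} x p∣N = cycEdgeW-cong m₁ n₂ {x % N} {x} (m∣n⇒o%n%m≡o%m _ N x p∣N)

  bracketEdges : ℕ → ℕ → ℕ → ℕ → ℕ
  bracketEdges m₁ n₂ s k = cycEdgeW m₁ n₂ (k + s)

  module _ (m₁ n₂ s : ℕ) where
    private
      E = bracketEdges m₁ n₂ s
      p = suc m₁ + n₂

    bracketEdges-period : IsPeriod E p
    bracketEdges-period k =
      cycEdgeW-cong m₁ n₂ {p + k + s} {k + s}
        (trans (cong (_% p) (+-assoc p k s)) (%-remove-+ˡ (k + s) (∣-refl {p})))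

    DegreeRelation-bracketEdges-shift : ∀ {a b} k →
      DegreeRelation a b (E k) (E (1 + k)) (E (2 + k)) (E (3 + k)) →
      DegreeRelation a b (E (p + k)) (E (p + (1 + k))) (E (p + (2 + k))) (E (p + (3 + k)))
    DegreeRelation-bracketEdges-shift k = DegreeRelation-cong
      (sym (bracketEdges-period k)) (sym (bracketEdges-period (1 + k)))
      (sym (bracketEdges-period (2 + k))) (sym (bracketEdges-period (3 + k)))

    bracketEdges-period-pred : ∀ N → IsPeriod E (p + N) → IsPeriod E N
    bracketEdges-period-pred N per k = begin
      E (N + k)        ≡⟨ bracketEdges-period (N + k) ⟨
      E (p + (N + k))  ≡⟨ cong E (+-assoc p N k) ⟨
      E (p + N + k)    ≡⟨ per k ⟩
      E k              ∎

  U3-relation : DegreeRelationAlong (+ 1) (+ 8) (bracketEdges 1 1 2)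
  U3-relation 0 = holds refl
  U3-relation 1 = holds refl
  U3-relation 2 = holds refl
  U3-relation (suc (suc (suc k))) = DegreeRelation-bracketEdges-shift 1 1 2 k (U3-relation k)

  U4-relation : DegreeRelationAlong (+ 4) -[1+ 1 ] (bracketEdges 2 2 0)
  U4-relation 0 = holds refl
  U4-relation 1 = holds refl
  U4-relation 2 = holds refl
  U4-relation 3 = holds refl
  U4-relation 4 = holds refl
  U4-relation (suc (suc (suc (suc (suc k))))) = DegreeRelation-bracketEdges-shift 2 2 0 k (U4-relation k)

  U5-relation : DegreeRelationAlong (+ 3) (+ 2) (bracketEdges 2 1 0)
  U5-relation 0 = holds refl
  U5-relation 1 = holds refl
  U5-relation 2 = holds refl
  U5-relation 3 = holds refl
  U5-relation (suc (suc (suc (suc k)))) = DegreeRelation-bracketEdges-shift 2 1 0 k (U5-relation k)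

  U3-period : ∀ N → IsPeriod (bracketEdges 1 1 2) N → 3 ∣ N
  U3-period 0 _ = 3 ∣0
  U3-period 1 per = contradiction (per 0) λ ()
  U3-period 2 per = contradiction (per 0) λ ()
  U3-period (suc (suc (suc N))) per =
    ∣m∣n⇒∣m+n ∣-refl (U3-period N (bracketEdges-period-pred 1 1 2 N per))

  U4-period : ∀ N → IsPeriod (bracketEdges 2 2 0) N → 5 ∣ N
  U4-period 0 _ = 5 ∣0
  U4-period 1 per = contradiction (per 2) λ ()
  U4-period 2 per = contradiction (per 1) λ ()
  U4-period 3 per = contradiction (per 0) λ ()
  U4-period 4 per = contradiction (per 0) λ ()
  U4-period (suc (suc (suc (suc (suc N))))) per =
    ∣m∣n⇒∣m+n ∣-refl (U4-period N (bracketEdges-period-pred 2 2 0 N per))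

  U5-period : ∀ N → IsPeriod (bracketEdges 2 1 0) N → 4 ∣ N
  U5-period 0 _ = 4 ∣0
  U5-period 1 per = contradiction (per 2) λ ()
  U5-period 2 per = contradiction (per 1) λ ()
  U5-period 3 per = contradiction (per 0) λ ()
  U5-period (suc (suc (suc (suc N)))) per =
    ∣m∣n⇒∣m+n ∣-refl (U5-period N (bracketEdges-period-pred 2 1 0 N per))

  -- Classification of the weight sequences beginning x, 2, 2, 1

  one-or-two : ∀ {x} → 1 ≤ x → x ≤ 2 → x ≡ 1 ⊎ x ≡ 2
  one-or-two {1} _ _ = inj₁ refl
  one-or-two {2} _ _ = inj₂ refl
  one-or-two {suc (suc (suc _))} _ (s≤s (s≤s ()))

  classify : ∀ {a b} (D : ℕ → ℕ) → (∀ k → 1 ≤ D k) → (∀ k → D k ≤ 2) → DegreeRelationAlong a b D →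
             D 1 ≡ 2 → D 2 ≡ 2 → D 3 ≡ 1 →
             D ≗ bracketEdges 1 1 2 ⊎ D ≗ bracketEdges 2 2 0 ⊎ D ≗ bracketEdges 2 1 0
  classify {a} {b} D D≥1 D≤2 rel d₁ d₂ d₃ = cases (one-or-two (D≥1 0) (D≤2 0)) (one-or-two (D≥1 4) (D≤2 4))
    where
    coefficients : ∀ {a′ b′ x u} → D 0 ≡ x → D 4 ≡ u →
                   DegreeRelation a′ b′ x 2 2 1 → DegreeRelation a′ b′ 2 2 1 u → a ≡ a′ × b ≡ b′
    coefficients d₀ d₄ r₀ r₁ = affine-determined-by-3-and-4
      (trans (equation (DegreeRelation-cong d₀ d₁ d₂ d₃ (rel 0))) (sym (equation r₀)))
      (trans (equation (DegreeRelation-cong d₁ d₂ d₃ d₄ (rel 1))) (sym (equation r₁)))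

    relation-with : ∀ {a′ b′ x y z u} → a ≡ a′ × b ≡ b′ →
                    DegreeRelation a b x y z u → DegreeRelation a′ b′ x y z u
    relation-with (refl , refl) r = r

    agrees-with : ∀ {a′ b′ P} → DegreeRelationAlong a′ b′ P → a ≡ a′ × b ≡ b′ →
                  D 0 ≡ P 0 → D 1 ≡ P 1 → D 2 ≡ P 2 → D ≗ P
    agrees-with relP ab = DegreeRelationAlong-unique D≥1 (relation-with ab ∘ rel) relP

    cases : D 0 ≡ 1 ⊎ D 0 ≡ 2 → D 4 ≡ 1 ⊎ D 4 ≡ 2 →
            D ≗ bracketEdges 1 1 2 ⊎ D ≗ bracketEdges 2 2 0 ⊎ D ≗ bracketEdges 2 1 0
    cases (inj₁ d₀) (inj₁ d₄) = contradiction (subst (_≤ 2) d₅ (D≤2 5)) λ { (s≤s (s≤s ())) }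
      where
      d₅ : D 5 ≡ 4
      d₅ = DegreeRelation-unique (s≤s z≤n)
             (relation-with (coefficients {+ 2} {+ 4} d₀ d₄ (holds refl) (holds refl))
                            (DegreeRelation-cong d₂ d₃ d₄ refl (rel 2)))
             (holds refl)
    cases (inj₁ d₀) (inj₂ d₄) =
      inj₁ (agrees-with U3-relation (coefficients d₀ d₄ (holds refl) (holds refl)) d₀ d₁ d₂)
    cases (inj₂ d₀) (inj₁ d₄) =
      inj₂ (inj₁ (agrees-with U4-relation (coefficients d₀ d₄ (holds refl) (holds refl)) d₀ d₁ d₂))
    cases (inj₂ d₀) (inj₂ d₄) =
      inj₂ (inj₂ (agrees-with U5-relation (coefficients d₀ d₄ (holds refl) (holds refl)) d₀ d₁ d₂))

  -- Multigraphs whose B-graph is a cycle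

  cycleWeights : ∀ {N} → (ℕ → ℕ) → Fin N → Fin N → ℕ
  cycleWeights Q i j =
    if ⌊ j ≟ sucMod i ⌋ then Q (toℕ i)
    else if ⌊ i ≟ sucMod j ⌋ then Q (toℕ j)
    else 0

  module CycleMultigraph {m} (H : Multigraph012 (suc m)) (cyc : Fin (suc m) ⤖ Fin (suc m))
                         (isCycle : IsBCycle H cyc) (m≥2 : 2 ≤ m) where

    vertex position : Fin (suc m) → Fin (suc m)
    vertex   = Bijection.to cyc
    position = Bijection.to (⤖-sym cyc)

    vertex-position : ∀ u → vertex (position u) ≡ u
    vertex-position = Surjection.to∘to⁻ (Bijection.surjection cyc)

    edge : Fin (suc m) → ℕ
    edge i = w H (vertex i) (vertex (sucMod i))

    edge-positive : ∀ i → 1 ≤ edge i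
    edge-positive i = proj₂ (isCycle i (sucMod i)) (inj₁ refl)

    w-nonadjacent : ∀ {i j} → j ≢ sucMod i → i ≢ sucMod j → w H (vertex i) (vertex j) ≡ 0
    w-nonadjacent j≢ i≢ = n<1⇒n≡0 (≰⇒> λ adjacent → [ j≢ , i≢ ]′ (proj₁ (isCycle _ _) adjacent))

    w-non-neighbour : ∀ i u → u ≢ vertex i → u ≢ vertex (sucMod (sucMod i)) → w H u (vertex (sucMod i)) ≡ 0
    w-non-neighbour i u u≢ u≢′ = begin
      w H u (vertex (sucMod i))                      ≡⟨ cong (λ v → w H v _) (vertex-position u) ⟨
      w H (vertex (position u)) (vertex (sucMod i))  ≡⟨ w-nonadjacent si≢ pu≢ ⟩
      0                                              ∎
      where
      si≢ : sucMod i ≢ sucMod (position u)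
      si≢ eq = u≢ (trans (sym (vertex-position u)) (cong vertex (sym (Bijection.injective sucMod-⤖ eq))))
      pu≢ : position u ≢ sucMod (sucMod i)
      pu≢ eq = u≢′ (trans (sym (vertex-position u)) (cong vertex eq))

    neighbours-distinct : ∀ i → vertex i ≢ vertex (sucMod (sucMod i))
    neighbours-distinct i eq = rotate-two-≢ m≥2 i (sym (Bijection.injective cyc eq))

    deg-sucMod : ∀ i → deg H (vertex (sucMod i)) ≡ edge i + edge (sucMod i)
    deg-sucMod i = trans (sumFin-pair _ (neighbours-distinct i) (w-non-neighbour i))
                         (cong (_+_ (edge i)) (w-sym H _ _))

    sdeg-sucMod : ∀ i → sdeg H (vertex (sucMod i)) ≡
                        edge i * deg H (vertex i) + edge (sucMod i) * deg H (vertex (sucMod (sucMod i)))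
    sdeg-sucMod i =
      trans (sumFin-pair _ (neighbours-distinct i) (λ u u≢ u≢′ → cong (_* deg H u) (w-non-neighbour i u u≢ u≢′)))
            (cong (λ x → edge i * deg H (vertex i) + x * deg H (vertex (sucMod (sucMod i)))) (w-sym H _ _))

    edgesFrom : Fin (suc m) → ℕ → ℕ
    edgesFrom i₀ k = edge (rotate k i₀)

    edgesFrom≡w : ∀ i₀ k {i j} → rotate k i₀ ≡ i → rotate (suc k) i₀ ≡ j →
                  edgesFrom i₀ k ≡ w H (vertex i) (vertex j)
    edgesFrom≡w i₀ k = cong₂ (λ i j → w H (vertex i) (vertex j))

    ≗edgesFrom-period : ∀ {i₀ Q} → edgesFrom i₀ ≗ Q → IsPeriod Q (suc m)
    ≗edgesFrom-period {i₀} {Q} edgesFrom≗ k = begin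
      Q (suc m + k)                        ≡⟨ edgesFrom≗ (suc m + k) ⟨
      edge (rotate (suc m + k) i₀)         ≡⟨ cong edge (rotate-+ (suc m) k i₀) ⟩
      edge (rotate (suc m) (rotate k i₀))  ≡⟨ cong edge (rotate-period (rotate k i₀)) ⟩
      edge (rotate k i₀)                   ≡⟨ edgesFrom≗ k ⟩
      Q k                                  ∎

    edgesFrom-relation : ∀ a b → (∀ v → a ℤ.* (+ deg H v) ℤ.+ b ≡ + sdeg H v) →
                         ∀ i₀ → DegreeRelationAlong a b (edgesFrom i₀)
    edgesFrom-relation a b sdeg≡ i₀ k = holds (begin
      a ℤ.* + (edge j + edge (sucMod j)) ℤ.+ b  ≡⟨ cong (λ d → a ℤ.* + d ℤ.+ b) (deg-sucMod j) ⟨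
      a ℤ.* + deg H (vertex (sucMod j)) ℤ.+ b   ≡⟨ sdeg≡ (vertex (sucMod j)) ⟩
      + sdeg H (vertex (sucMod j))              ≡⟨ cong +_ (trans (sdeg-sucMod j) neighbour-degrees) ⟩
      + (edge j * (edge i + edge j) + edge (sucMod j) * (edge (sucMod j) + edge (sucMod (sucMod j)))) ∎)
      where
      i = rotate k i₀
      j = sucMod i
      neighbour-degrees = cong₂ _+_ (cong (edge j *_) (deg-sucMod i))
                                    (cong (edge (sucMod j) *_) (deg-sucMod (sucMod j)))

    w≡cycleWeights-rotate : ∀ Q r → (∀ i → edge i ≡ Q (toℕ (rotate r i))) →
                            ∀ i j → w H (vertex i) (vertex j) ≡ cycleWeights Q (rotate r i) (rotate r j)
    w≡cycleWeights-rotate Q r edge≡ i j with rotate r j ≟ sucMod (rotate r i) | rotate r i ≟ sucMod (rotate r j)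
    ... | yes eq | _      = trans (cong (λ j → w H (vertex i) (vertex j)) (rotate-≡-sucMod r eq)) (edge≡ i)
    ... | no _   | yes eq = trans (w-sym H _ _)
                              (trans (cong (λ i → w H (vertex j) (vertex i)) (rotate-≡-sucMod r eq)) (edge≡ j))
    ... | no j≢  | no i≢  = w-nonadjacent (λ eq → j≢ (trans (cong (rotate r) eq) (rotate-sucMod r i)))
                                          (λ eq → i≢ (trans (cong (rotate r) eq) (rotate-sucMod r j)))

    isomorphic-cycleWeights : ∀ {N} (Q : ℕ → ℕ) r → suc m ≡ N → (∀ i → edge i ≡ Q (toℕ (rotate r i))) →
                              Isomorphic H (cycleWeights {N} Q)
    isomorphic-cycleWeights Q r refl edge≡ = rotation r ⤖-∘ ⤖-sym cyc , λ u v → begin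
      w H u v
        ≡⟨ cong₂ (w H) (vertex-position u) (vertex-position v) ⟨
      w H (vertex (position u)) (vertex (position v))
        ≡⟨ w≡cycleWeights-rotate Q r edge≡ (position u) (position v) ⟩
      cycleWeights Q (rotate r (position u)) (rotate r (position v))
        ≡⟨ cong₂ (cycleWeights Q) (to-rotation r (position u)) (to-rotation r (position v)) ⟨
      cycleWeights Q (Bijection.to (rotation r) (position u)) (Bijection.to (rotation r) (position v)) ∎

    edge≡rotated : ∀ (Q : ℕ → ℕ) d s {i₀} → (∀ x → Q (x % suc m) ≡ Q x) → rotate d i₀ ≡ zero →
                   (∀ k → edgesFrom i₀ k ≡ Q (k + s)) → ∀ i → edge i ≡ Q (toℕ (rotate (d + s) i))
    edge≡rotated Q d s {i₀} Q-mod start≡ edgesFrom≡ i = begin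
      edge i                       ≡⟨ cong edge i≡ ⟨
      edgesFrom i₀ (toℕ i + d)     ≡⟨ edgesFrom≡ (toℕ i + d) ⟩
      Q (toℕ i + d + s)            ≡⟨ cong Q (trans (+-assoc (toℕ i) d s) (+-comm (toℕ i) (d + s))) ⟩
      Q (d + s + toℕ i)            ≡⟨ Q-mod (d + s + toℕ i) ⟨
      Q ((d + s + toℕ i) % suc m)  ≡⟨ cong Q (toℕ-rotate (d + s) i) ⟨
      Q (toℕ (rotate (d + s) i))   ∎
      where
      i≡ : rotate (toℕ i + d) i₀ ≡ i
      i≡ = trans (rotate-+ (toℕ i) d i₀) (trans (cong (rotate (toℕ i)) start≡) (rotate-toℕ i))

    bracket-isomorphic : ∀ m₁ n₂ s {i₀} d → rotate d i₀ ≡ zero →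
                         (∀ N → IsPeriod (bracketEdges m₁ n₂ s) N → suc m₁ + n₂ ∣ N) →
                         edgesFrom i₀ ≗ bracketEdges m₁ n₂ s →
                         ∃[ t ] (1 ≤ t × Isomorphic H (bracketW m₁ n₂ t))
    bracket-isomorphic m₁ n₂ s d start≡ periods edgesFrom≗ with periods (suc m) (≗edgesFrom-period edgesFrom≗)
    ... | divides (suc t) 1+m≡[1+t]p = suc t , s≤s z≤n ,
      isomorphic-cycleWeights (cycEdgeW m₁ n₂) (d + s) (trans 1+m≡[1+t]p (*-comm (suc t) (suc m₁ + n₂)))
        (edge≡rotated (cycEdgeW m₁ n₂) d s (λ x → cycEdgeW-% m₁ n₂ x (divides (suc t) 1+m≡[1+t]p))
                      start≡ edgesFrom≗)

open import Data.Integer using (ℤ; +_; _+_; _*_)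
open import Data.Nat using (suc; z≤n; s≤s)
open import Data.Fin using (zero; suc; fromℕ; inject₁)
open import Data.Product using (map₂)
open import Data.Sum using (inj₁; inj₂)
open import Relation.Binary.PropositionalEquality using (trans; cong; _≗_)
open import Function using (_∘_)

theorem3p6 : {c ℓ : Level} (R : CommutativeRing c ℓ) (n : ℕ) (n≥4 : 4 ≤ n)
    (H : Multigraph012 n) →
    Spectral.HasExactlyTwoMainEigenvalues R H →
    (cyc : Fin n ⤖ Fin n) → IsBCycle H cyc →
    (a b : ℤ) → (∀ v → a * (+ deg H v) + b ≡ + sdeg H v) →
    w H (Bijection.to cyc (pos0 n≥4)) (Bijection.to cyc (posLast n≥4)) ≡ 2 →
    w H (Bijection.to cyc (pos0 n≥4)) (Bijection.to cyc (pos1 n≥4)) ≡ 1 →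
    w H (Bijection.to cyc (posLast n≥4)) (Bijection.to cyc (posLast2 n≥4)) ≡ 2 →
    ∃[ t ] (1 ≤ t × (Isomorphic H (U3 t) ⊎ Isomorphic H (U4 t) ⊎ Isomorphic H (U5 t)))
-- The main-eigenvalue hypothesis is what yields a and b in the paper.
theorem3p6 _ (suc (suc (suc (suc m₁)))) (s≤s (s≤s (s≤s (s≤s _)))) H _ cyc isCycle a b sdeg≡
           u₁v₁≡2 u₁u₂≡1 v₁v₂≡2 =
  realise (classify D (λ k → edge-positive (rotate k start)) (λ k → w≤2 H _ _)
                      (edgesFrom-relation a b sdeg≡ start) D₁≡2 D₂≡2 D₃≡1)
  where
  open CycleMultigraph H cyc isCycle (s≤s (s≤s z≤n))
  -- position n − 3, so that D = e_{n−3}, e_{n−2} = w(v₂v₁), e_{n−1} = w(v₁u₁), e₀ = w(u₁u₂), …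
  start : Fin (suc (suc (suc (suc m₁))))
  start = inject₁ (inject₁ (fromℕ (suc m₁)))
  D : ℕ → ℕ
  D = edgesFrom start
  rotate₁ : rotate 1 start ≡ inject₁ (fromℕ (suc (suc m₁)))
  rotate₁ = sucMod-inject₁ _
  rotate₂ : rotate 2 start ≡ fromℕ (suc (suc (suc m₁)))
  rotate₂ = trans (cong sucMod rotate₁) (sucMod-inject₁ _)
  rotate₃ : rotate 3 start ≡ zero
  rotate₃ = trans (cong sucMod rotate₂) sucMod-fromℕ
  rotate₄ : rotate 4 start ≡ suc zero
  rotate₄ = trans (cong sucMod rotate₃) (sucMod-inject₁ zero)
  D₁≡2 : D 1 ≡ 2
  D₁≡2 = trans (edgesFrom≡w start 1 rotate₁ rotate₂) (trans (w-sym H _ _) v₁v₂≡2)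
  D₂≡2 : D 2 ≡ 2
  D₂≡2 = trans (edgesFrom≡w start 2 rotate₂ rotate₃) (trans (w-sym H _ _) u₁v₁≡2)
  D₃≡1 : D 3 ≡ 1
  D₃≡1 = trans (edgesFrom≡w start 3 rotate₃ rotate₄) u₁u₂≡1
  realise : D ≗ bracketEdges 1 1 2 ⊎ D ≗ bracketEdges 2 2 0 ⊎ D ≗ bracketEdges 2 1 0 →
            ∃[ t ] (1 ≤ t × (Isomorphic H (U3 t) ⊎ Isomorphic H (U4 t) ⊎ Isomorphic H (U5 t)))
  realise (inj₁ D≗U3)        = map₂ (map₂ inj₁) (bracket-isomorphic 1 1 2 3 rotate₃ U3-period D≗U3)
  realise (inj₂ (inj₁ D≗U4)) = map₂ (map₂ (inj₂ ∘ inj₁)) (bracket-isomorphic 2 2 0 3 rotate₃ U4-period D≗U4)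
  realise (inj₂ (inj₂ D≗U5)) = map₂ (map₂ (inj₂ ∘ inj₂)) (bracket-isomorphic 2 1 0 3 rotate₃ U5-period D≗U5)
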